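{- Let $f$ be a constraint and $\mathcal{G}$ a set of constraints, and assume that $f$ is T-constructible from $\mathcal{G}$ without using the projection operation. (1) If every constraint in $\mathcal{G}$ has imp support, then $f$ has imp support. (2) If every constraint in $\mathcal{G}$ belongs to $\mathcal{ED}$, then $f$ belongs to $\mathcal{ED}$.
   Context: A constraint of arity $k\ge1$ is a function $f:\{0,1\}^k\to\mathbb{C}$. $Implies(x,y)=0$ if $(x,y)=(1,0)$ and $1$ otherwise; $\Delta_0(0)=1,\Delta_0(1)=0$, $\Delta_1(0)=0,\Delta_1(1)=1$; $EQ(x,y)=1$ iff $x=y$ (else $0$); $XOR=1-EQ$. The underlying relation is $R_f=\{a:f(a)\ne0\}$. $IMP$ is the set of relations logically equivalent to a conjunction of a positive number of relations of the forms $\Delta_0(x_i)$, $\Delta_1(x_i)$, $Implies(x_i,x_j)$ (the empty relation belongs to $IMP$); $f$ has imp support if $R_f\in IMP$. $\mathcal{ED}$ is the set of constraints $f$ of arity $k\ge1$ for which there are $\ell_1,\ell_2\ge0$ with $\ell_1+\ell_2\ge1$, unary constraints $h_i$, constraints $g_i\in\{EQ,XOR\}$ and indices $j_i,m_i,n_i\in[k]$ with $f(x_1,\dots,x_k)=\prod_{i=1}^{\ell_1}h_i(x_{j_i})\prod_{i=1}^{\ell_2}g_i(x_{m_i},x_{n_i})$ for all inputs. T-constructibility from $\mathcal{G}$: obtaining $f$ from constraints in $\mathcal{G}$ by finitely many (possibly zero) applications of the operations: Permutation (swap two argument positions); Pinning ($g^{x_i=c}$, fixing argument $i$ to $c\in\{0,1\}$);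 Projection ($g^{x_i=*}=\sum_{x_i\in\{0,1\}}g$); Linking ($g^{x_i=x_j}$ for distinct $i,j$, substituting $x_j$ for $x_i$); Expansion (adding a dummy argument on which the function does not depend); Multiplication (pointwise product $g_1\cdot g_2$ of two constraints on the same variable tuple); Normalization ($\lambda\cdot g$ for $\lambda\in\mathbb{C}\setminus\{0\}$). -}

module Defs where

open import Level using (Level; _⊔_; suc)
open import Data.Bool using (Bool; true; false; _∧_; not; if_then_else_)
open import Data.Nat using (ℕ; zero) renaming (suc to sucℕ)
open import Data.Fin using (Fin)
open import Data.Vec using (Vec; lookup; insertAt; removeAt; _[_]≔_)
open import Data.List.NonEmpty using (List⁺; foldr₁; map)
open import Data.Product using (Σ; ∃; ∃-syntax; _×_; _,_)
open import Relation.Nullary using (¬_)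
open import Relation.Binary.PropositionalEquality using (_≡_)
open import Algebra.Bundles using (CommutativeRing)

-- The codomain of constraints.  ℂ is not available in agda-stdlib, so we
-- work over an arbitrary field (a commutative ring with 1 ≉ 0 in which
-- every nonzero element has a multiplicative inverse).

record Field (c ℓ : Level) : Set (suc (c ⊔ ℓ)) where
  field
    commutativeRing : CommutativeRing c ℓ
  open CommutativeRing commutativeRing public
  field
    1≉0     : ¬ (1# ≈ 0#)
    inverse : ∀ x → ¬ (x ≈ 0#) → ∃[ y ] (x * y ≈ 1#)

module Constraints {c ℓ : Level} (F : Field c ℓ) where
  open Field F

  -- A constraint of arity k = suc n ≥ 1 : a function {0,1}^k → F.
  Fn : ℕ → Set c
  Fn n = Vec Bool (sucℕ n) → Carrier

  Constraint : Set c
  Constraint = Σ ℕ Fn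

  -- T-constructibility.  The Bool parameter says whether the projection
  -- operation may be used.

  swap : ∀ {k} → Fin k → Fin k → Vec Bool k → Vec Bool k
  swap i j x = (x [ i ]≔ lookup x j) [ j ]≔ lookup x i

  data TCon {ℓG : Level} (G : Constraint → Set ℓG) (proj : Bool)
         : (n : ℕ) → Fn n → Set (c ⊔ ℓ ⊔ suc ℓG) where
    base : ∀ {n} {f g : Fn n} → G (n , g) → (∀ x → f x ≈ g x) → TCon G proj n f
    ext : ∀ {n} {f g : Fn n} → TCon G proj n g → (∀ x → f x ≈ g x) → TCon G proj n f
    permutation : ∀ {n} {g : Fn n} (i j : Fin (sucℕ n)) → TCon G proj n g →
      TCon G proj n (λ x → g (swap i j x))
    pinning : ∀ {n} {g : Fn (sucℕ n)} (i : Fin (sucℕ (sucℕ n))) (b : Bool) →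
      TCon G proj (sucℕ n) g → TCon G proj n (λ x → g (insertAt x i b))
    projection : ∀ {n} {g : Fn (sucℕ n)} (i : Fin (sucℕ (sucℕ n))) → proj ≡ true →
      TCon G proj (sucℕ n) g →
      TCon G proj n (λ x → g (insertAt x i false) + g (insertAt x i true))
    -- linking: argument i is replaced by (a copy of) another argument,
    -- namely position j among the remaining arguments; i disappears
    linking : ∀ {n} {g : Fn (sucℕ n)} (i : Fin (sucℕ (sucℕ n))) (j : Fin (sucℕ n)) →
      TCon G proj (sucℕ n) g → TCon G proj n (λ x → g (insertAt x i (lookup x j)))
    expansion : ∀ {n} {g : Fn n} (i : Fin (sucℕ (sucℕ n))) →
      TCon G proj n g → TCon G proj (sucℕ n) (λ x → g (removeAt x i))
    multiplication : ∀ {n} {g₁ g₂ : Fn n} → TCon G proj n g₁ → TCon G proj n g₂ →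
      TCon G proj n (λ x → g₁ x * g₂ x)
    normalization : ∀ {n} {g : Fn n} (λ′ : Carrier) → ¬ (λ′ ≈ 0#) →
      TCon G proj n g → TCon G proj n (λ x → λ′ * g x)

  TConstructibleNoProj : ∀ {ℓG} → (G : Constraint → Set ℓG) → Constraint → Set (c ⊔ ℓ ⊔ suc ℓG)
  TConstructibleNoProj G (n , f) = TCon G false n f

  data ImpAtom (k : ℕ) : Set where
    Δ₀      : Fin k → ImpAtom k
    Δ₁      : Fin k → ImpAtom k
    implies : Fin k → Fin k → ImpAtom k

  impVal : Bool → Bool → Bool
  impVal true false = false
  impVal _    _     = true

  atomVal : ∀ {k} → ImpAtom k → Vec Bool k → Bool
  atomVal (Δ₀ i)        x = not (lookup x i)
  atomVal (Δ₁ i)        x = lookup x i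
  atomVal (implies i j) x = impVal (lookup x i) (lookup x j)

  conjVal : ∀ {k} → List⁺ (ImpAtom k) → Vec Bool k → Bool
  conjVal as x = foldr₁ _∧_ (map (λ a → atomVal a x) as)

  HasImpSupport : Constraint → Set ℓ
  HasImpSupport (n , f) = ∃[ as ] (∀ x → (¬ (f x ≈ 0#) → conjVal as x ≡ true)
                                        × (conjVal as x ≡ true → ¬ (f x ≈ 0#)))

  EQ : Bool → Bool → Carrier
  EQ true  true  = 1#
  EQ false false = 1#
  EQ _     _     = 0#

  XOR : Bool → Bool → Carrier
  XOR x y = 1# - EQ x y

  data EDFactor (k : ℕ) : Set c where
    unary : (Bool → Carrier) → Fin k → EDFactor k
    eq    : Fin k → Fin k → EDFactor k
    xor   : Fin k → Fin k → EDFactor k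

  factorVal : ∀ {k} → EDFactor k → Vec Bool k → Carrier
  factorVal (unary h j) x = h (lookup x j)
  factorVal (eq m n)    x = EQ (lookup x m) (lookup x n)
  factorVal (xor m n)   x = XOR (lookup x m) (lookup x n)

  prodVal : ∀ {k} → List⁺ (EDFactor k) → Vec Bool k → Carrier
  prodVal fs x = foldr₁ _*_ (map (λ φ → factorVal φ x) fs)

  InED : Constraint → Set (c ⊔ ℓ)
  InED (n , f) = ∃[ fs ] (∀ x → f x ≈ prodVal fs x)

module Submission where

-- Apart from multiplication and normalization, every operation of a
-- projection-free T-construction (permutation, pinning, linking, expansion)
-- turns g into g ∘ T where each coordinate of T x is either a coordinate of
-- x or a constant; we call such a map an instantiation by literals.  Both
-- classes are described by a product (of Boolean atoms, resp. of field
-- factors) whose atoms mention single variables or pairs of variables, so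
-- substituting literals into the atoms, atom by atom, describes g ∘ T.

open import Defs
open import Level using (Level; _⊔_)
open import Data.Bool using (Bool; true; false; _∧_; not)
open import Data.Bool.Properties using (∧-semigroup)
open import Data.Nat using (ℕ) renaming (suc to sucℕ)
open import Data.Fin using (Fin; zero; suc; punchIn; punchOut; _≟_)
open import Data.Fin.Properties using (punchIn-punchOut)
open import Data.Vec using (Vec; lookup; tabulate; insertAt; removeAt; _[_]≔_)
open import Data.Vec.Properties
  using (lookup∘tabulate; tabulate∘lookup; tabulate-cong; insertAt-lookup;
         insertAt-punchIn; insertAt-removeAt; lookup∘update; lookup∘update′)
open import Data.List using (List; []; _∷_)
open import Data.List.NonEmpty using (List⁺; _∷_; _∷⁺_; _⁺++⁺_; foldr₁; map)
open import Data.List.NonEmpty.Properties using (map-⁺++⁺; map-∘; map-cong)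
open import Data.Product using (_×_; _,_; proj₁; proj₂)
open import Data.Sum using (_⊎_; inj₁; inj₂)
open import Algebra.Bundles using (Semigroup)
open import Relation.Nullary using (¬_; yes; no)
open import Relation.Binary.PropositionalEquality
  using (_≡_; refl; sym; trans; cong; cong₂; module ≡-Reasoning)

lookup-removeAt : ∀ {a} {A : Set a} {n} (x : Vec A (sucℕ n)) (i : Fin (sucℕ n)) (k : Fin n) →
  lookup (removeAt x i) k ≡ lookup x (punchIn i k)
lookup-removeAt x i k = begin
  lookup (removeAt x i) k
    ≡⟨ sym (insertAt-punchIn (removeAt x i) i (lookup x i) k) ⟩
  lookup (insertAt (removeAt x i) i (lookup x i)) (punchIn i k)
    ≡⟨ cong (λ v → lookup v (punchIn i k)) (insertAt-removeAt x i) ⟩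
  lookup x (punchIn i k) ∎
  where open ≡-Reasoning

flatMapFrom : ∀ {a b} {A : Set a} {B : Set b} → (A → List⁺ B) → A → List A → List⁺ B
flatMapFrom s a []       = s a
flatMapFrom s a (b ∷ as) = s a ⁺++⁺ flatMapFrom s b as

flatMap : ∀ {a b} {A : Set a} {B : Set b} → (A → List⁺ B) → List⁺ A → List⁺ B
flatMap s (a ∷ as) = flatMapFrom s a as

module Folds {c ℓ} (S : Semigroup c ℓ) where
  open Semigroup S renaming (refl to ≈-refl; sym to ≈-sym)
  open import Relation.Binary.Reasoning.Setoid setoid

  fold-⁺++⁺ : ∀ xs ys → foldr₁ _∙_ (xs ⁺++⁺ ys) ≈ foldr₁ _∙_ xs ∙ foldr₁ _∙_ ys
  fold-⁺++⁺ (x ∷ xs) ys@(_ ∷ _) = fold-from x xs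
    where
    fold-from : ∀ x xs → foldr₁ _∙_ ((x ∷ xs) ⁺++⁺ ys) ≈ foldr₁ _∙_ (x ∷ xs) ∙ foldr₁ _∙_ ys
    fold-from x []        = ≈-refl
    fold-from x (x′ ∷ xs) = begin
      x ∙ foldr₁ _∙_ ((x′ ∷ xs) ⁺++⁺ ys)           ≈⟨ ∙-congˡ (fold-from x′ xs) ⟩
      x ∙ (foldr₁ _∙_ (x′ ∷ xs) ∙ foldr₁ _∙_ ys)   ≈⟨ ≈-sym (assoc x _ _) ⟩
      (x ∙ foldr₁ _∙_ (x′ ∷ xs)) ∙ foldr₁ _∙_ ys   ∎

  fold-flatMap : ∀ {a b} {A : Set a} {B : Set b} (s : A → List⁺ B)
    (v : A → Carrier) (w : B → Carrier) → (∀ a → foldr₁ _∙_ (map w (s a)) ≈ v a) →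
    ∀ as → foldr₁ _∙_ (map w (flatMap s as)) ≈ foldr₁ _∙_ (map v as)
  fold-flatMap s v w sound (a ∷ as) = fold-from a as
    where
    fold-from : ∀ a as → foldr₁ _∙_ (map w (flatMapFrom s a as)) ≈ foldr₁ _∙_ (map v (a ∷ as))
    fold-from a []       = sound a
    fold-from a (b ∷ as) = begin
      foldr₁ _∙_ (map w (s a ⁺++⁺ flatMapFrom s b as))
        ≡⟨ cong (foldr₁ _∙_) (map-⁺++⁺ w (s a) (flatMapFrom s b as)) ⟩
      foldr₁ _∙_ (map w (s a) ⁺++⁺ map w (flatMapFrom s b as))
        ≈⟨ fold-⁺++⁺ (map w (s a)) (map w (flatMapFrom s b as)) ⟩
      foldr₁ _∙_ (map w (s a)) ∙ foldr₁ _∙_ (map w (flatMapFrom s b as))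
        ≈⟨ ∙-cong (sound a) (fold-from b as) ⟩
      v a ∙ foldr₁ _∙_ (map v (b ∷ as)) ∎

module ProjectionFree {c ℓ : Level} (F : Field c ℓ) where
  open Field F
    renaming (refl to ≈-refl; sym to ≈-sym; trans to ≈-trans; reflexive to ≈-reflexive)
    hiding (zero)
  open Constraints F

  cancel-nonzero : ∀ {a b} → ¬ (a ≈ 0#) → a * b ≈ 0# → b ≈ 0#
  cancel-nonzero {a} {b} a≉0 ab≈0 with inverse a a≉0
  ... | a⁻¹ , aa⁻¹≈1 = begin
    b                ≈⟨ ≈-sym (*-identityˡ b) ⟩
    1# * b           ≈⟨ *-congʳ (≈-sym aa⁻¹≈1) ⟩
    (a * a⁻¹) * b    ≈⟨ *-congʳ (*-comm a a⁻¹) ⟩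
    (a⁻¹ * a) * b    ≈⟨ *-assoc a⁻¹ a b ⟩
    a⁻¹ * (a * b)    ≈⟨ *-congˡ ab≈0 ⟩
    a⁻¹ * 0#         ≈⟨ zeroʳ a⁻¹ ⟩
    0#               ∎
    where open import Relation.Binary.Reasoning.Setoid setoid

  *-nonzero : ∀ {a b} → ¬ (a ≈ 0#) → ¬ (b ≈ 0#) → ¬ (a * b ≈ 0#)
  *-nonzero a≉0 b≉0 ab≈0 = b≉0 (cancel-nonzero a≉0 ab≈0)

  nonzero-factorˡ : ∀ {a b} → ¬ (a * b ≈ 0#) → ¬ (a ≈ 0#)
  nonzero-factorˡ {a} {b} ab≉0 a≈0 = ab≉0 (≈-trans (*-congʳ a≈0) (zeroˡ b))

  nonzero-factorʳ : ∀ {a b} → ¬ (a * b ≈ 0#) → ¬ (b ≈ 0#)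
  nonzero-factorʳ {a} {b} ab≉0 b≈0 = ab≉0 (≈-trans (*-congˡ b≈0) (zeroʳ a))

  Literal : ℕ → Set
  Literal m = Fin (sucℕ m) ⊎ Bool

  ⟦_⟧ : ∀ {m} → Literal m → Vec Bool (sucℕ m) → Bool
  ⟦ inj₁ j ⟧ x = lookup x j
  ⟦ inj₂ b ⟧ x = b

  instantiate : ∀ {n m} → (Fin (sucℕ n) → Literal m) → Vec Bool (sucℕ m) → Vec Bool (sucℕ n)
  instantiate σ x = tabulate (λ k → ⟦ σ k ⟧ x)

  instantiate-lookup : ∀ {n m} (σ : Fin (sucℕ n) → Literal m) x k →
    lookup (instantiate σ x) k ≡ ⟦ σ k ⟧ x
  instantiate-lookup σ x = lookup∘tabulate (λ k → ⟦ σ k ⟧ x)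

  IsInstantiation : ∀ {n m} → (Fin (sucℕ n) → Literal m) →
    (Vec Bool (sucℕ m) → Vec Bool (sucℕ n)) → Set
  IsInstantiation σ T = ∀ x k → lookup (T x) k ≡ ⟦ σ k ⟧ x

  instantiation-ext : ∀ {n m} (σ : Fin (sucℕ n) → Literal m) {T} →
    IsInstantiation σ T → ∀ x → T x ≡ instantiate σ x
  instantiation-ext σ {T} isInst x = begin
    T x                          ≡⟨ sym (tabulate∘lookup (T x)) ⟩
    tabulate (lookup (T x))      ≡⟨ tabulate-cong (isInst x) ⟩
    instantiate σ x              ∎
    where open ≡-Reasoning

  swapLiteral : ∀ {n} (i j k : Fin (sucℕ n)) → Literal n
  swapLiteral i j k with k ≟ j | k ≟ i
  ... | yes _ | _     = inj₁ i
  ... | no _  | yes _ = inj₁ j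
  ... | no _  | no _  = inj₁ k

  swap-instantiation : ∀ {n} (i j : Fin (sucℕ n)) → IsInstantiation (swapLiteral i j) (swap i j)
  swap-instantiation i j x k with k ≟ j | k ≟ i
  ... | yes refl | _        = lookup∘update k (x [ i ]≔ lookup x k) (lookup x i)
  ... | no k≢j   | yes refl = trans (lookup∘update′ k≢j (x [ k ]≔ lookup x j) (lookup x k))
                                    (lookup∘update k x (lookup x j))
  ... | no k≢j   | no k≢i   = trans (lookup∘update′ k≢j (x [ i ]≔ lookup x j) (lookup x i))
                                    (lookup∘update′ k≢i x (lookup x j))

  -- Inserting the literal l at position i (pinning: l constant; linking:
  -- l a variable); the other positions read the variables in order.
  insertLiteral : ∀ {m} (i : Fin (sucℕ (sucℕ m))) (l : Literal m) (k : Fin (sucℕ (sucℕ m))) → Literal m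
  insertLiteral i l k with i ≟ k
  ... | yes _   = l
  ... | no i≢k  = inj₁ (punchOut i≢k)

  insert-instantiation : ∀ {m} (i : Fin (sucℕ (sucℕ m))) (l : Literal m) →
    IsInstantiation (insertLiteral i l) (λ x → insertAt x i (⟦ l ⟧ x))
  insert-instantiation i l x k with i ≟ k
  ... | yes refl = insertAt-lookup x i _
  ... | no i≢k   = trans (cong (lookup (insertAt x i _)) (sym (punchIn-punchOut i≢k)))
                         (insertAt-punchIn x i _ (punchOut i≢k))

  remove-instantiation : ∀ {n} (i : Fin (sucℕ (sucℕ n))) →
    IsInstantiation (λ k → inj₁ (punchIn i k)) (λ x → removeAt x i)
  remove-instantiation i x k = lookup-removeAt x i k

  record ProjectionFreeClosed {p} (P : Constraint → Set p) : Set (c ⊔ ℓ ⊔ p) where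
    field
      respects-≈    : ∀ {n} {f g : Fn n} → (∀ x → f x ≈ g x) → P (n , g) → P (n , f)
      instantiation : ∀ {n m} {g : Fn n} (σ : Fin (sucℕ n) → Literal m) →
                      P (n , g) → P (m , λ x → g (instantiate σ x))
      product       : ∀ {n} {g₁ g₂ : Fn n} → P (n , g₁) → P (n , g₂) → P (n , λ x → g₁ x * g₂ x)
      scaling       : ∀ {n} {g : Fn n} (λ′ : Carrier) → ¬ (λ′ ≈ 0#) →
                      P (n , g) → P (n , λ x → λ′ * g x)

    instantiation-via : ∀ {n m} {g : Fn n} (σ : Fin (sucℕ n) → Literal m) {T} →
      IsInstantiation σ T → P (n , g) → P (m , λ x → g (T x))
    instantiation-via {g = g} σ {T} isInst Pg =
      respects-≈ (λ x → ≈-reflexive (cong g (instantiation-ext σ {T} isInst x))) (instantiation σ Pg)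

  projectionFree-induction : ∀ {p ℓG} {P : Constraint → Set p} {G : Constraint → Set ℓG} →
    ProjectionFreeClosed P → (∀ g → G g → P g) → ∀ {n f} → TCon G false n f → P (n , f)
  projectionFree-induction {P = P} {G} closed inG = go
    where
    open ProjectionFreeClosed closed
    go : ∀ {n f} → TCon G false n f → P (n , f)
    go (base Gg e)         = respects-≈ e (inG _ Gg)
    go (ext t e)           = respects-≈ e (go t)
    go (permutation i j t) =
      instantiation-via (swapLiteral i j) (swap-instantiation i j) (go t)
    go (pinning i b t)     =
      instantiation-via (insertLiteral i (inj₂ b)) (insert-instantiation i (inj₂ b)) (go t)
    go (projection i () t)
    go (linking i j t)     =
      instantiation-via (insertLiteral i (inj₁ j)) (insert-instantiation i (inj₁ j)) (go t)
    go (expansion i t)     =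
      instantiation-via (λ k → inj₁ (punchIn i k)) (remove-instantiation i) (go t)
    go (multiplication t₁ t₂)    = product (go t₁) (go t₂)
    go (normalization λ′ λ′≉0 t) = scaling λ′ λ′≉0 (go t)

  open Folds ∧-semigroup using (fold-⁺++⁺; fold-flatMap)

  conjVal-⁺++⁺ : ∀ {k} (as bs : List⁺ (ImpAtom k)) x →
    conjVal (as ⁺++⁺ bs) x ≡ conjVal as x ∧ conjVal bs x
  conjVal-⁺++⁺ as bs x = trans (cong (foldr₁ _∧_) (map-⁺++⁺ (λ a → atomVal a x) as bs))
                               (fold-⁺++⁺ (map (λ a → atomVal a x) as) (map (λ a → atomVal a x) bs))

  -- The constant relations are in IMP: x₀ → x₀ and ¬x₀ ∧ x₀.
  constAtoms : ∀ {m} → Bool → List⁺ (ImpAtom (sucℕ m))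
  constAtoms true  = implies zero zero ∷ []
  constAtoms false = Δ₀ zero ∷ Δ₁ zero ∷ []

  constAtoms-sound : ∀ {m} b (x : Vec Bool (sucℕ m)) → conjVal (constAtoms b) x ≡ b
  constAtoms-sound true  x with lookup x zero
  ... | true  = refl
  ... | false = refl
  constAtoms-sound false x with lookup x zero
  ... | true  = refl
  ... | false = refl

  literalAtoms : ∀ {m} → Literal m → List⁺ (ImpAtom (sucℕ m))
  literalAtoms (inj₁ j) = Δ₁ j ∷ []
  literalAtoms (inj₂ b) = constAtoms b

  literalAtoms-sound : ∀ {m} (l : Literal m) x → conjVal (literalAtoms l) x ≡ ⟦ l ⟧ x
  literalAtoms-sound (inj₁ j) x = refl
  literalAtoms-sound (inj₂ b) x = constAtoms-sound b x

  negLiteralAtoms : ∀ {m} → Literal m → List⁺ (ImpAtom (sucℕ m))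
  negLiteralAtoms (inj₁ j) = Δ₀ j ∷ []
  negLiteralAtoms (inj₂ b) = constAtoms (not b)

  negLiteralAtoms-sound : ∀ {m} (l : Literal m) x → conjVal (negLiteralAtoms l) x ≡ not (⟦ l ⟧ x)
  negLiteralAtoms-sound (inj₁ j) x = refl
  negLiteralAtoms-sound (inj₂ b) x = constAtoms-sound (not b) x

  impliesAtoms : ∀ {m} → Literal m → Literal m → List⁺ (ImpAtom (sucℕ m))
  impliesAtoms (inj₂ false) l            = constAtoms true
  impliesAtoms (inj₂ true)  l            = literalAtoms l
  impliesAtoms (inj₁ a)     (inj₁ b)     = implies a b ∷ []
  impliesAtoms (inj₁ a)     (inj₂ true)  = constAtoms true
  impliesAtoms (inj₁ a)     (inj₂ false) = Δ₀ a ∷ []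

  impliesAtoms-sound : ∀ {m} (l₁ l₂ : Literal m) x →
    conjVal (impliesAtoms l₁ l₂) x ≡ impVal (⟦ l₁ ⟧ x) (⟦ l₂ ⟧ x)
  impliesAtoms-sound (inj₂ false) l x = constAtoms-sound true x
  impliesAtoms-sound (inj₂ true)  l x with ⟦ l ⟧ x | literalAtoms-sound l x
  ... | true  | e = e
  ... | false | e = e
  impliesAtoms-sound (inj₁ a) (inj₁ b) x = refl
  impliesAtoms-sound (inj₁ a) (inj₂ true) x with lookup x a
  ... | true  = constAtoms-sound true x
  ... | false = constAtoms-sound true x
  impliesAtoms-sound (inj₁ a) (inj₂ false) x with lookup x a
  ... | true  = refl
  ... | false = refl

  substAtom : ∀ {n m} → (Fin (sucℕ n) → Literal m) → ImpAtom (sucℕ n) → List⁺ (ImpAtom (sucℕ m))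
  substAtom σ (Δ₀ i)        = negLiteralAtoms (σ i)
  substAtom σ (Δ₁ i)        = literalAtoms (σ i)
  substAtom σ (implies i j) = impliesAtoms (σ i) (σ j)

  substAtom-sound : ∀ {n m} (σ : Fin (sucℕ n) → Literal m) a x →
    conjVal (substAtom σ a) x ≡ atomVal a (instantiate σ x)
  substAtom-sound σ (Δ₀ i) x =
    trans (negLiteralAtoms-sound (σ i) x) (cong not (sym (instantiate-lookup σ x i)))
  substAtom-sound σ (Δ₁ i) x =
    trans (literalAtoms-sound (σ i) x) (sym (instantiate-lookup σ x i))
  substAtom-sound σ (implies i j) x =
    trans (impliesAtoms-sound (σ i) (σ j) x)
          (sym (cong₂ impVal (instantiate-lookup σ x i) (instantiate-lookup σ x j)))

  substConj-sound : ∀ {n m} (σ : Fin (sucℕ n) → Literal m) as x →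
    conjVal (flatMap (substAtom σ) as) x ≡ conjVal as (instantiate σ x)
  substConj-sound σ as x =
    fold-flatMap (substAtom σ) (λ a → atomVal a (instantiate σ x)) (λ a → atomVal a x)
                 (λ a → substAtom-sound σ a x) as

  Supports : ∀ {n} → List⁺ (ImpAtom (sucℕ n)) → Fn n → Set ℓ
  Supports as f = ∀ x → (¬ (f x ≈ 0#) → conjVal as x ≡ true) × (conjVal as x ≡ true → ¬ (f x ≈ 0#))

  supports-≈ : ∀ {n} {as} {f g : Fn n} → (∀ x → f x ≈ g x) → Supports as g → Supports as f
  supports-≈ f≈g supp x =
    (λ fx≉0 → proj₁ (supp x) (λ gx≈0 → fx≉0 (≈-trans (f≈g x) gx≈0))) ,
    (λ holds fx≈0 → proj₂ (supp x) holds (≈-trans (≈-sym (f≈g x)) fx≈0))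

  supports-instantiate : ∀ {n m} (σ : Fin (sucℕ n) → Literal m) {as} {g : Fn n} →
    Supports as g → Supports (flatMap (substAtom σ) as) (λ x → g (instantiate σ x))
  supports-instantiate σ {as} supp x =
    (λ nz → trans (substConj-sound σ as x) (proj₁ (supp (instantiate σ x)) nz)) ,
    (λ holds → proj₂ (supp (instantiate σ x)) (trans (sym (substConj-sound σ as x)) holds))

  ∧-true : ∀ {p q} → p ∧ q ≡ true → (p ≡ true) × (q ≡ true)
  ∧-true {true} {true} _ = refl , refl

  -- The support of a product is the intersection of the supports, because a
  -- field has no zero divisors.
  supports-product : ∀ {n} as bs {g₁ g₂ : Fn n} → Supports as g₁ → Supports bs g₂ →
    Supports (as ⁺++⁺ bs) (λ x → g₁ x * g₂ x)
  supports-product as bs supp₁ supp₂ x =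
    (λ nz → trans (conjVal-⁺++⁺ as bs x)
               (cong₂ _∧_ (proj₁ (supp₁ x) (nonzero-factorˡ nz))
                          (proj₁ (supp₂ x) (nonzero-factorʳ nz)))) ,
    (λ holds → let both = ∧-true (trans (sym (conjVal-⁺++⁺ as bs x)) holds) in
               *-nonzero (proj₂ (supp₁ x) (proj₁ both)) (proj₂ (supp₂ x) (proj₂ both)))

  supports-scaling : ∀ {n} {as} {g : Fn n} {λ′} → ¬ (λ′ ≈ 0#) →
    Supports as g → Supports as (λ x → λ′ * g x)
  supports-scaling λ′≉0 supp x =
    (λ nz → proj₁ (supp x) (nonzero-factorʳ nz)) ,
    (λ holds → *-nonzero λ′≉0 (proj₂ (supp x) holds))

  impSupport-closed : ProjectionFreeClosed HasImpSupport
  impSupport-closed = record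
    { respects-≈    = λ f≈g (as , supp) → as , supports-≈ {as = as} f≈g supp
    ; instantiation = λ σ (as , supp) → flatMap (substAtom σ) as , supports-instantiate σ {as} supp
    ; product       = λ (as , supp₁) (bs , supp₂) → as ⁺++⁺ bs , supports-product as bs supp₁ supp₂
    ; scaling       = λ _ λ′≉0 (as , supp) → as , supports-scaling {as = as} λ′≉0 supp
    }

  prodVal-⁺++⁺ : ∀ {k} (as bs : List⁺ (EDFactor k)) x →
    prodVal (as ⁺++⁺ bs) x ≈ prodVal as x * prodVal bs x
  prodVal-⁺++⁺ as bs x =
    ≈-trans (≈-reflexive (cong (foldr₁ _*_) (map-⁺++⁺ value as bs)))
            (Folds.fold-⁺++⁺ *-semigroup (map value as) (map value bs))
    where
    value : EDFactor _ → Carrier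
    value φ = factorVal φ x

  unaryAt : ∀ {m} → (Bool → Carrier) → Literal m → EDFactor (sucℕ m)
  unaryAt h (inj₁ j) = unary h j
  unaryAt h (inj₂ b) = unary (λ _ → h b) zero

  unaryAt-sound : ∀ {m} h (l : Literal m) x → factorVal (unaryAt h l) x ≡ h (⟦ l ⟧ x)
  unaryAt-sound h (inj₁ j) x = refl
  unaryAt-sound h (inj₂ b) x = refl

  binaryAt : ∀ {m} (B : Bool → Bool → Carrier) → (Fin (sucℕ m) → Fin (sucℕ m) → EDFactor (sucℕ m)) →
    Literal m → Literal m → EDFactor (sucℕ m)
  binaryAt B factor (inj₁ a) (inj₁ b) = factor a b
  binaryAt B factor (inj₁ a) (inj₂ b) = unary (λ y → B y b) a
  binaryAt B factor (inj₂ a) l        = unaryAt (B a) l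

  binaryAt-sound : ∀ {m} (B : Bool → Bool → Carrier) factor →
    (∀ a b x → factorVal (factor a b) x ≡ B (lookup x a) (lookup x b)) →
    ∀ (l₁ l₂ : Literal m) x → factorVal (binaryAt B factor l₁ l₂) x ≡ B (⟦ l₁ ⟧ x) (⟦ l₂ ⟧ x)
  binaryAt-sound B factor sound (inj₁ a) (inj₁ b) x = sound a b x
  binaryAt-sound B factor sound (inj₁ a) (inj₂ b) x = refl
  binaryAt-sound B factor sound (inj₂ a) l        x = unaryAt-sound (B a) l x

  substFactor : ∀ {n m} → (Fin (sucℕ n) → Literal m) → EDFactor (sucℕ n) → EDFactor (sucℕ m)
  substFactor σ (unary h i) = unaryAt h (σ i)
  substFactor σ (eq i j)    = binaryAt EQ eq (σ i) (σ j)
  substFactor σ (xor i j)   = binaryAt XOR xor (σ i) (σ j)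

  substFactor-sound : ∀ {n m} (σ : Fin (sucℕ n) → Literal m) φ x →
    factorVal (substFactor σ φ) x ≡ factorVal φ (instantiate σ x)
  substFactor-sound σ (unary h i) x =
    trans (unaryAt-sound h (σ i) x) (cong h (sym (instantiate-lookup σ x i)))
  substFactor-sound σ (eq i j) x =
    trans (binaryAt-sound EQ eq (λ _ _ _ → refl) (σ i) (σ j) x)
          (sym (cong₂ EQ (instantiate-lookup σ x i) (instantiate-lookup σ x j)))
  substFactor-sound σ (xor i j) x =
    trans (binaryAt-sound XOR xor (λ _ _ _ → refl) (σ i) (σ j) x)
          (sym (cong₂ XOR (instantiate-lookup σ x i) (instantiate-lookup σ x j)))

  substProd-sound : ∀ {n m} (σ : Fin (sucℕ n) → Literal m) fs x →
    prodVal (map (substFactor σ) fs) x ≡ prodVal fs (instantiate σ x)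
  substProd-sound σ fs x = cong (foldr₁ _*_) (begin
    map (λ φ → factorVal φ x) (map (substFactor σ) fs)
      ≡⟨ sym (map-∘ fs) ⟩
    map (λ φ → factorVal (substFactor σ φ) x) fs
      ≡⟨ map-cong (λ φ → substFactor-sound σ φ x) fs ⟩
    map (λ φ → factorVal φ (instantiate σ x)) fs ∎)
    where open ≡-Reasoning

  ed-closed : ProjectionFreeClosed InED
  ed-closed = record
    { respects-≈    = λ f≈g (fs , g≈) → fs , λ x → ≈-trans (f≈g x) (g≈ x)
    ; instantiation = λ σ (fs , g≈) → map (substFactor σ) fs , λ x →
        ≈-trans (g≈ (instantiate σ x)) (≈-reflexive (sym (substProd-sound σ fs x)))
    ; product       = λ (fs , g₁≈) (gs , g₂≈) → fs ⁺++⁺ gs , λ x →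
        ≈-trans (*-cong (g₁≈ x) (g₂≈ x)) (≈-sym (prodVal-⁺++⁺ fs gs x))
    -- a scalar is a constant unary factor
    ; scaling       = λ λ′ _ (fs , g≈) → unary (λ _ → λ′) zero ∷⁺ fs , λ x → *-congˡ (g≈ x)
    }

lemma7p2 : ∀ {c ℓ ℓG : Level} (F : Field c ℓ) → let open Constraints F in
    (G : Constraint → Set ℓG) (f : Constraint) → TConstructibleNoProj G f →
    ((∀ g → G g → HasImpSupport g) → HasImpSupport f)
    × ((∀ g → G g → InED g) → InED f)
lemma7p2 F G (n , f) t =
    (λ inG → projectionFree-induction impSupport-closed inG t)
  , (λ inG → projectionFree-induction ed-closed inG t)
  where open ProjectionFree F
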